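{- Let $\epsilon>0$ and let $A\subseteq\{ -1,1\}^k$ be modular free and $\epsilon$-somewhat spread. Then for every $x\in\{ -1,1\}^k$ and every sufficiently large odd integer $\ell$, the vector $(x_1,\ldots,x_k,\ell)\in\mathbb{Z}^{k+1}$ can be written as a non-negative integer combination of the vectors $a'$, $a\in A$.
   Context: For $a\in\{ -1,1\}^k$, $a'=(a_1,\ldots,a_k,1)\in\mathbb{Z}^{k+1}$. $A$ is modular free if the lattice (set of all integer linear combinations) generated by $\{a':a\in A\}$ equals the set of all vectors in $\mathbb{Z}^{k+1}$ all of whose coordinates have the same parity. $A$ is $\epsilon$-somewhat spread if for every unit vector $u\in\mathbb{R}^k$ there is $a\in A$ with $\langle a,u\rangle\le-\epsilon$.
   Formalization: The parameter ε is rational, and the unit vectors $u\in\mathbb{R}^k$ in the definition of ε-somewhat spread are replaced by nonzero rational directions. -}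

module Defs where

open import Data.Nat as ℕ using (ℕ; suc)
open import Data.Integer as ℤ using (ℤ; +_; _-_)
open import Data.Integer.Divisibility as ℤD using ()
open import Data.Rational as ℚ using (ℚ; 0ℚ; 1ℚ)
open import Data.Sign using (Sign)
open import Data.Fin using (Fin)
open import Data.Vec using (Vec; []; _∷_; map; zipWith; replicate; lookup; _∷ʳ_; foldr)
open import Data.List using (List; []; _∷_; length)
open import Data.List.Membership.Propositional using (_∈_)
open import Data.Product using (Σ; _×_; ∃)
open import Function.Bundles using (_⇔_)

PM : ℕ → Set
PM k = Vec Sign k

signℤ : Sign → ℤ
signℤ Sign.+ = + 1
signℤ Sign.- = ℤ.-[1+ 0 ]

signℚ : Sign → ℚ
signℚ Sign.+ = 1ℚ
signℚ Sign.- = ℚ.- 1ℚ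

toℤv : ∀ {k} → PM k → Vec ℤ k
toℤv = map signℤ

prime : ∀ {k} → PM k → Vec ℤ (suc k)
prime a = toℤv a ∷ʳ + 1

combℤ : ∀ {k} (A : List (PM k)) → Vec ℤ (length A) → Vec ℤ (suc k)
combℤ []      []       = replicate _ (+ 0)
combℤ (a ∷ A) (c ∷ cs) = zipWith ℤ._+_ (map (c ℤ.*_) (prime a)) (combℤ A cs)

combℕ : ∀ {k} (A : List (PM k)) → Vec ℕ (length A) → Vec ℤ (suc k)
combℕ A c = combℤ A (map +_ c)

SameParity : ∀ {n} → Vec ℤ n → Set
SameParity v = ∀ i j → + 2 ℤD.∣ (lookup v i - lookup v j)

InLattice : ∀ {k} → List (PM k) → Vec ℤ (suc k) → Set
InLattice A v = ∃ λ (c : Vec ℤ (length A)) → combℤ A c ≡ v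
  where open import Relation.Binary.PropositionalEquality using (_≡_)

ModularFree : ∀ {k} → List (PM k) → Set
ModularFree A = ∀ v → InLattice A v ⇔ SameParity v

dotℚ : ∀ {k} → Vec ℚ k → Vec ℚ k → ℚ
dotℚ u v = foldr _ ℚ._+_ 0ℚ (zipWith ℚ._*_ u v)

-- ε-somewhat spread, quantifying over nonzero rational directions u:
-- ⟨a, u/|u|⟩ ≤ -ε  ⇔  ⟨a,u⟩ ≤ 0 ∧ ε²⟨u,u⟩ ≤ ⟨a,u⟩².
SomewhatSpread : ∀ {k} → ℚ → List (PM k) → Set
SomewhatSpread {k} ε A =
  ∀ (u : Vec ℚ k) → 0ℚ ℚ.< dotℚ u u →
    ∃ λ a → a ∈ A × (dotℚ (map signℚ a) u ℚ.≤ 0ℚ)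
          × (ε ℚ.* ε ℚ.* dotℚ u u ℚ.≤ dotℚ (map signℚ a) u ℚ.* dotℚ (map signℚ a) u)

-- Modular freeness yields integer combinations of the vectors a' = (a, 1) equal to (x, 1) and
-- to (0, 2). Being somewhat spread means that no u ≠ 0 has ⟨a, u⟩ ≥ 0 for every a ∈ A, so by
-- Fourier–Motzkin elimination the a ∈ A positively span ℤ^k; spanning -Σ a gives a relation
-- Σ w_a a = 0 with every w_a ≥ 1, of height N = Σ w_a. Adding j < N copies of the (0, 2)
-- combination and M copies of w to the (x, 1) combination, with M even and large, makes all
-- coefficients nonnegative, and the height 1 + 2j + M N then runs through all large odd numbers.

module Submission where

open import Defs
open import Data.Nat using (ℕ; _≤_; _%_)
open import Data.Integer using (+_)
open import Data.Rational using (ℚ; 0ℚ; _<_)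
open import Data.Vec using (Vec; _∷ʳ_)
open import Data.List using (List; length)
open import Data.Product using (∃; Σ)
open import Relation.Binary.PropositionalEquality using (_≡_)

import Data.Integer.Properties as ℤP
open import Algebra.Properties.CommutativeSemigroup ℤP.+-commutativeSemigroup using (interchange)
open import Data.Empty using (⊥; ⊥-elim)
open import Data.Integer as ℤ
  using (ℤ; +0; +[1+_]; -[1+_]; 0ℤ; 1ℤ; -1ℤ; ∣_∣; _+_; _*_; -_; _-_; +≤+; +<+; -<+)
import Data.Integer.Divisibility as ℤD
open import Data.Integer.Divisibility.Signed as ℤDˢ using (∣ᵤ⇒∣; ∣⇒∣ᵤ; ∣m∣n⇒∣m-n)
open import Data.Integer.Tactic.RingSolver using (solve-∀)
open import Data.List as List using ([]; _∷_; cartesianProduct)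
open import Data.List.Membership.Propositional using (_∈_; find; lose)
open import Data.List.Membership.Propositional.Properties
  using (∈-map⁺; ∈-map⁻; ∈-filter⁺; ∈-filter⁻; ∈-cartesianProduct⁺; ∈-cartesianProduct⁻)
import Data.List.Relation.Unary.All as ListAll
open import Data.List.Relation.Unary.Any using (Any; here; there; any?)
import Data.List.Relation.Unary.Any.Properties as AnyP
open import Data.Nat as ℕ using (zero; suc; z≤n; s≤s; _/_)
import Data.Nat.Divisibility as ℕD
open import Data.Nat.DivMod using (m≡m%n+[m/n]*n; m%n<n; m*n/n≡m; /-monoˡ-≤)
import Data.Nat.Properties as ℕP
import Data.Nat.Tactic.RingSolver as ℕ-Solver
open import Data.Product using (_×_; _,_; proj₁; proj₂; ∃₂)
import Data.Rational as ℚ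
open import Data.Rational.Literals using (fromℤ)
import Data.Rational.Properties as ℚP
open import Data.Rational.Unnormalised as ℚᵘ using (ℚᵘ; mkℚᵘ)
import Data.Rational.Unnormalised.Properties as ℚᵘP
open import Data.List.Extrema ℚᵘP.≤-totalOrder using (argmin; argmin-all; f[argmin]≤f[xs])
open import Data.Sign as Sign using (Sign)
open import Data.Sum using (inj₁; inj₂)
open import Data.Vec as Vec using ([]; _∷_; head; tail; map; zipWith; replicate)
open import Data.Vec.Properties
  using (map-cong; map-id; map-const; map-∘; map-replicate; map-∷ʳ; zipWith-replicate;
         zipWith-identityˡ; zipWith-identityʳ; ∷ʳ-injective)
import Data.Vec.Relation.Unary.All as All
open All using (All; []; _∷_)
import Data.Vec.Relation.Unary.All.Properties as AllP
open import Function using (_∘_)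
open import Function.Bundles using (Equivalence)
open import Relation.Binary.Definitions using (tri<; tri≈; tri>)
open import Relation.Binary.PropositionalEquality
  using (_≢_; ≢-sym; refl; sym; trans; cong; cong₂; subst; subst₂; module ≡-Reasoning)
open import Relation.Nullary using (yes; no)
open import Relation.Nullary.Decidable using (_×-dec_)
open import Relation.Unary using (Decidable)

private
  variable
    k n : ℕ

infixl 6 _+ᵛ_
infixr 7 _*ᵛ_
infix  8 _∙_

_+ᵛ_ : Vec ℤ n → Vec ℤ n → Vec ℤ n
_+ᵛ_ = zipWith _+_

_*ᵛ_ : ℤ → Vec ℤ n → Vec ℤ n
c *ᵛ v = map (c *_) v

0ᵛ : Vec ℤ n
0ᵛ = replicate _ 0ℤ

_∙_ : Vec ℤ n → Vec ℤ n → ℤ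
[]      ∙ []      = 0ℤ
(x ∷ u) ∙ (y ∷ v) = x * y + u ∙ v

+ᵛ-identityˡ : (v : Vec ℤ n) → 0ᵛ +ᵛ v ≡ v
+ᵛ-identityˡ = zipWith-identityˡ ℤP.+-identityˡ

+ᵛ-identityʳ : (v : Vec ℤ n) → v +ᵛ 0ᵛ ≡ v
+ᵛ-identityʳ = zipWith-identityʳ ℤP.+-identityʳ

+ᵛ-interchange : (u v w x : Vec ℤ n) → (u +ᵛ v) +ᵛ (w +ᵛ x) ≡ (u +ᵛ w) +ᵛ (v +ᵛ x)
+ᵛ-interchange []      []      []      []      = refl
+ᵛ-interchange (a ∷ u) (b ∷ v) (c ∷ w) (d ∷ x) =
  cong₂ _∷_ (interchange a b c d) (+ᵛ-interchange u v w x)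

*ᵛ-identityˡ : (v : Vec ℤ n) → 1ℤ *ᵛ v ≡ v
*ᵛ-identityˡ v = trans (map-cong ℤP.*-identityˡ v) (map-id v)

*ᵛ-zeroˡ : (v : Vec ℤ n) → 0ℤ *ᵛ v ≡ 0ᵛ
*ᵛ-zeroˡ v = trans (map-cong ℤP.*-zeroˡ v) (map-const v 0ℤ)

*ᵛ-zeroʳ : ∀ n c → c *ᵛ 0ᵛ {n} ≡ 0ᵛ
*ᵛ-zeroʳ n c = trans (map-replicate (c *_) 0ℤ n) (cong (replicate n) (ℤP.*-zeroʳ c))

*ᵛ-assoc : ∀ c d (v : Vec ℤ n) → (c * d) *ᵛ v ≡ c *ᵛ d *ᵛ v
*ᵛ-assoc c d v = trans (map-cong (ℤP.*-assoc c d) v) (map-∘ (c *_) (d *_) v)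

*ᵛ-distribˡ-+ᵛ : ∀ c (u v : Vec ℤ n) → c *ᵛ (u +ᵛ v) ≡ c *ᵛ u +ᵛ c *ᵛ v
*ᵛ-distribˡ-+ᵛ c []      []      = refl
*ᵛ-distribˡ-+ᵛ c (x ∷ u) (y ∷ v) = cong₂ _∷_ (ℤP.*-distribˡ-+ c x y) (*ᵛ-distribˡ-+ᵛ c u v)

*ᵛ-distribʳ-+ : (v : Vec ℤ n) → ∀ c d → (c + d) *ᵛ v ≡ c *ᵛ v +ᵛ d *ᵛ v
*ᵛ-distribʳ-+ []      c d = refl
*ᵛ-distribʳ-+ (x ∷ v) c d = cong₂ _∷_ (ℤP.*-distribʳ-+ x c d) (*ᵛ-distribʳ-+ v c d)

*ᵛ≡0ᵛ⇒≡0ᵛ : ∀ {c} (v : Vec ℤ n) → c ≢ 0ℤ → c *ᵛ v ≡ 0ᵛ → v ≡ 0ᵛ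
*ᵛ≡0ᵛ⇒≡0ᵛ []      c≢0 _    = refl
*ᵛ≡0ᵛ⇒≡0ᵛ {c = c} (x ∷ v) c≢0 cv≡0 with ℤP.i*j≡0⇒i≡0∨j≡0 c (cong head cv≡0)
... | inj₁ c≡0 = ⊥-elim (c≢0 c≡0)
... | inj₂ x≡0 = cong₂ _∷_ x≡0 (*ᵛ≡0ᵛ⇒≡0ᵛ v c≢0 (cong tail cv≡0))

∙-zeroʳ : (u : Vec ℤ n) → u ∙ 0ᵛ ≡ 0ℤ
∙-zeroʳ []      = refl
∙-zeroʳ (x ∷ u) = trans (cong (_+_ (x * 0ℤ)) (∙-zeroʳ u)) (trans (ℤP.+-identityʳ _) (ℤP.*-zeroʳ x))

∙-distribʳ-+ᵛ : (u v w : Vec ℤ n) → (u +ᵛ v) ∙ w ≡ u ∙ w + v ∙ w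
∙-distribʳ-+ᵛ []      []      []      = refl
∙-distribʳ-+ᵛ (x ∷ u) (y ∷ v) (z ∷ w) =
  trans (cong₂ _+_ (ℤP.*-distribʳ-+ z x y) (∙-distribʳ-+ᵛ u v w))
        (interchange (x * z) (y * z) (u ∙ w) (v ∙ w))

*ᵛ-∙ : ∀ c (u v : Vec ℤ n) → (c *ᵛ u) ∙ v ≡ c * (u ∙ v)
*ᵛ-∙ c []      []      = sym (ℤP.*-zeroʳ c)
*ᵛ-∙ c (x ∷ u) (y ∷ v) = trans (cong (_+_ (c * x * y)) (*ᵛ-∙ c u v)) (regroup c x y (u ∙ v))
  where
  regroup : ∀ c x y s → c * x * y + c * s ≡ c * (x * y + s)
  regroup = solve-∀

∙-*ᵛ : ∀ c (u v : Vec ℤ n) → u ∙ (c *ᵛ v) ≡ c * (u ∙ v)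
∙-*ᵛ c []      []      = sym (ℤP.*-zeroʳ c)
∙-*ᵛ c (x ∷ u) (y ∷ v) = trans (cong (_+_ (x * (c * y))) (∙-*ᵛ c u v)) (regroup c x y (u ∙ v))
  where
  regroup : ∀ c x y s → x * (c * y) + c * s ≡ c * (x * y + s)
  regroup = solve-∀

0≤i*j : ∀ {i j} → 0ℤ ℤ.≤ i → 0ℤ ℤ.≤ j → 0ℤ ℤ.≤ i * j
0≤i*j (+≤+ {n = a} _) (+≤+ {n = b} _) = subst (0ℤ ℤ.≤_) (ℤP.pos-* a b) (+≤+ z≤n)

0≤i*i : ∀ i → 0ℤ ℤ.≤ i * i
0≤i*i (+ n)    = 0≤i*j {+ n} {+ n} (+≤+ z≤n) (+≤+ z≤n)
0≤i*i -[1+ _ ] = +≤+ z≤n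

0≤u∙u : (u : Vec ℤ n) → 0ℤ ℤ.≤ u ∙ u
0≤u∙u []      = +≤+ z≤n
0≤u∙u (x ∷ u) = ℤP.+-mono-≤ (0≤i*i x) (0≤u∙u u)

0<u∙u : (u : Vec ℤ n) → u ≢ 0ᵛ → 0ℤ ℤ.< u ∙ u
0<u∙u []             u≢0 = ⊥-elim (u≢0 refl)
0<u∙u (+0 ∷ u)       u≢0 =
  subst (0ℤ ℤ.<_) (sym (ℤP.+-identityˡ (u ∙ u))) (0<u∙u u (u≢0 ∘ cong (0ℤ ∷_)))
0<u∙u (+[1+ _ ] ∷ u) _   = ℤP.+-mono-<-≤ (+<+ (s≤s z≤n)) (0≤u∙u u)
0<u∙u (-[1+ _ ] ∷ u) _   = ℤP.+-mono-<-≤ (+<+ (s≤s z≤n)) (0≤u∙u u)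

-- Cones and Fourier–Motzkin elimination

-- The integral, ε-free content of being somewhat spread.
Spread : List (Vec ℤ k) → Set
Spread A = ∀ u → u ≢ 0ᵛ → ∃ λ a → a ∈ A × a ∙ u ℤ.< 0ℤ

infixl 6 _+ᶜ_
infixr 7 _*ᶜ_

data Cone (A : List (Vec ℤ k)) : Vec ℤ k → Set where
  0ᶜ   : Cone A 0ᵛ
  gen  : ∀ {a} → a ∈ A → Cone A a
  _+ᶜ_ : ∀ {u v} → Cone A u → Cone A v → Cone A (u +ᵛ v)
  _*ᶜ_ : ∀ {v} (c : ℕ) → Cone A v → Cone A (+ c *ᵛ v)

PositivelySpans : List (Vec ℤ k) → Set
PositivelySpans A = ∀ v → ∃ λ s → Cone A (+[1+ s ] *ᵛ v)

∙-first : ∀ h c (t : Vec ℤ n) → (h ∷ t) ∙ (c ∷ 0ᵛ) ≡ h * c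
∙-first h c t = trans (cong (_+_ (h * c)) (∙-zeroʳ t)) (ℤP.+-identityʳ (h * c))

positive-head : {A : List (Vec ℤ (suc k))} → Spread A → ∃ λ p → p ∈ A × 0ℤ ℤ.< head p
positive-head spread with spread (-1ℤ ∷ 0ᵛ) (λ ())
... | h ∷ t , p∈A , p∙u<0 = h ∷ t , p∈A , ℤP.neg-cancel-< (subst (ℤ._< 0ℤ) p∙u≡-h p∙u<0)
  where
  p∙u≡-h : (h ∷ t) ∙ (-1ℤ ∷ 0ᵛ) ≡ - h
  p∙u≡-h = trans (∙-first h -1ℤ t) (trans (ℤP.*-comm h -1ℤ) (ℤP.-1*i≡-i h))

negative-head : {A : List (Vec ℤ (suc k))} → Spread A → ∃ λ n → n ∈ A × head n ℤ.< 0ℤ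
negative-head spread with spread (1ℤ ∷ 0ᵛ) (λ ())
... | h ∷ t , n∈A , n∙u<0 =
  h ∷ t , n∈A , subst (ℤ._< 0ℤ) (trans (∙-first h 1ℤ t) (ℤP.*-identityʳ h)) n∙u<0

pivot : {A : List (Vec ℤ (suc k))} → Spread A →
        ∀ h → ∃ λ b → b ∈ A × ∃₂ λ β γ → + γ * head b ≡ +[1+ β ] * h
pivot spread (+ γ) with positive-head spread
... | +[1+ β ] ∷ _ , b∈A , _     = _ , b∈A , β , γ , ℤP.*-comm (+ γ) +[1+ β ]
... | +0       ∷ _ , _   , +<+ ()
pivot spread -[1+ j ] with negative-head spread
... | -[1+ β ] ∷ _ , b∈A , _     = _ , b∈A , β , suc j , swap +[1+ j ] +[1+ β ]
  where
  swap : ∀ x y → x * - y ≡ y * - x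
  swap = solve-∀
... | + _      ∷ _ , _   , +<+ ()

module Elimination {k : ℕ} (A : List (Vec ℤ (suc k))) where

  Opposed : Vec ℤ (suc k) × Vec ℤ (suc k) → Set
  Opposed (p , n) = 0ℤ ℤ.≤ head p × head n ℤ.< 0ℤ

  opposed? : Decidable Opposed
  opposed? (p , n) = 0ℤ ℤ.≤? head p ×-dec head n ℤ.<? 0ℤ

  combine : Vec ℤ (suc k) × Vec ℤ (suc k) → Vec ℤ k
  combine (p , n) = (- head n) *ᵛ tail p +ᵛ head p *ᵛ tail n

  eliminated : List (Vec ℤ k)
  eliminated = List.map combine (List.filter opposed? (cartesianProduct A A))

  combine∈eliminated : ∀ {p n} → p ∈ A → n ∈ A → Opposed (p , n) → combine (p , n) ∈ eliminated
  combine∈eliminated p∈A n∈A opposed =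
    ∈-map⁺ combine (∈-filter⁺ opposed? (∈-cartesianProduct⁺ p∈A n∈A) opposed)

  combine-∙ : ∀ p n (u : Vec ℤ k) →
              combine (p , n) ∙ u ≡ (- head n) * (tail p ∙ u) + head p * (tail n ∙ u)
  combine-∙ p n u = trans (∙-distribʳ-+ᵛ ((- head n) *ᵛ tail p) (head p *ᵛ tail n) u)
                          (cong₂ _+_ (*ᵛ-∙ (- head n) (tail p) u) (*ᵛ-∙ (head p) (tail n) u))

  lift-combine : ∀ {p n} → p ∈ A → n ∈ A → Opposed (p , n) → Cone A (0ℤ ∷ combine (p , n))
  lift-combine {+ a ∷ tp} { -[1+ b ] ∷ tn} p∈A n∈A _ =
    subst (λ h → Cone A (h ∷ combine (+ a ∷ tp , -[1+ b ] ∷ tn))) (cancel +[1+ b ] (+ a))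
          (suc b *ᶜ gen p∈A +ᶜ a *ᶜ gen n∈A)
    where
    cancel : ∀ x y → x * y + y * - x ≡ 0ℤ
    cancel = solve-∀
  lift-combine { -[1+ _ ] ∷ _}            _ _ (() , _)
  lift-combine {+ _ ∷ _}      {+ _ ∷ _}   _ _ (_ , +<+ ())

  lift-gen : ∀ {a} → a ∈ eliminated → Cone A (0ℤ ∷ a)
  lift-gen a∈ with ∈-map⁻ combine a∈
  ... | (p , n) , pn∈ , refl with ∈-filter⁻ opposed? {xs = cartesianProduct A A} pn∈
  ... | pn∈A×A , opposed with ∈-cartesianProduct⁻ A A pn∈A×A
  ... | p∈A , n∈A = lift-combine p∈A n∈A opposed

  lift : ∀ {w} → Cone eliminated w → Cone A (0ℤ ∷ w)
  lift 0ᶜ             = 0ᶜ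
  lift (gen a∈)       = lift-gen a∈
  lift (x +ᶜ y)       = lift x +ᶜ lift y
  lift (_*ᶜ_ {v} c x) = subst (λ h → Cone A (h ∷ + c *ᵛ v)) (ℤP.*-zeroʳ (+ c)) (c *ᶜ lift x)

  -- If u ≠ 0 were weakly positive on the eliminated set, then with m ∈ A of positive head
  -- minimising the slope ⟨tail m, u⟩ / head m, all of A would lie in the half-space with normal
  -- (-⟨tail m, u⟩, head m · u).
  module HalfSpace (spread : Spread A) {u : Vec ℤ k}
                   (eliminated-nonneg : ∀ {a} → a ∈ eliminated → 0ℤ ℤ.≤ a ∙ u) where

    d : Vec ℤ (suc k) → ℤ
    d a = tail a ∙ u

    -- The denominator is kept as head a, so comparing slopes is cross-multiplying.
    slope : Vec ℤ (suc k) → ℚᵘ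
    slope a = mkℚᵘ (d a) (ℕ.pred ∣ head a ∣)

    slope-≤ : ∀ {a b} → 0ℤ ℤ.< head a → 0ℤ ℤ.< head b →
              slope a ℚᵘ.≤ slope b → d a * head b ℤ.≤ d b * head a
    slope-≤ {+[1+ _ ] ∷ _} {+[1+ _ ] ∷ _} _ _ (ℚᵘ.*≤* le) = le
    slope-≤ {+0 ∷ _}       (+<+ ())
    slope-≤ { -[1+ _ ] ∷ _} ()
    slope-≤ {_} {+0 ∷ _}       _ (+<+ ())
    slope-≤ {_} { -[1+ _ ] ∷ _} _ ()

    positive? : Decidable (λ (a : Vec ℤ (suc k)) → 0ℤ ℤ.< head a)
    positive? a = 0ℤ ℤ.<? head a

    positives : List (Vec ℤ (suc k))
    positives = List.filter positive? A

    m : Vec ℤ (suc k)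
    m = argmin slope (proj₁ (positive-head spread)) positives

    m∈A×0<hm : m ∈ A × 0ℤ ℤ.< head m
    m∈A×0<hm = argmin-all slope {P = λ a → a ∈ A × 0ℤ ℤ.< head a}
                 (proj₂ (positive-head spread)) (ListAll.tabulate (∈-filter⁻ positive?))

    m∈A : m ∈ A
    m∈A = proj₁ m∈A×0<hm

    0<hm : 0ℤ ℤ.< head m
    0<hm = proj₂ m∈A×0<hm

    m-minimal : ∀ {a} → a ∈ A → 0ℤ ℤ.< head a → d m * head a ℤ.≤ d a * head m
    m-minimal {a} a∈A 0<ha = slope-≤ {m} {a} 0<hm 0<ha
      (ListAll.lookup (f[argmin]≤f[xs] {f = slope} (proj₁ (positive-head spread)) positives)
                      (∈-filter⁺ positive? a∈A 0<ha))

    zero-head-nonneg : ∀ {a} → a ∈ A → head a ≡ 0ℤ → 0ℤ ℤ.≤ d a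
    zero-head-nonneg {a} a∈A ha≡0 with negative-head spread
    ... | + _ ∷ _ , _ , +<+ ()
    ... | n@(-[1+ b ] ∷ tn) , n∈A , _ = ℤP.*-cancelˡ-≤-pos 0ℤ (d a) +[1+ b ] (begin
      +[1+ b ] * 0ℤ                        ≡⟨ ℤP.*-zeroʳ +[1+ b ] ⟩
      0ℤ                                   ≤⟨ eliminated-nonneg (combine∈eliminated a∈A n∈A (a-opposed , -<+)) ⟩
      combine (a , n) ∙ u                  ≡⟨ combine-∙ a n u ⟩
      +[1+ b ] * d a + head a * (tn ∙ u)   ≡⟨ cong (λ h → +[1+ b ] * d a + h * (tn ∙ u)) ha≡0 ⟩
      +[1+ b ] * d a + 0ℤ                  ≡⟨ ℤP.+-identityʳ _ ⟩
      +[1+ b ] * d a                       ∎)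
      where
      open ℤP.≤-Reasoning
      a-opposed : 0ℤ ℤ.≤ head a
      a-opposed = ℤP.≤-reflexive (sym ha≡0)

    normal : Vec ℤ (suc k)
    normal = - d m ∷ head m *ᵛ u

    normal-∙ : ∀ a → a ∙ normal ≡ head m * d a - head a * d m
    normal-∙ (h ∷ t) =
      trans (cong (_+_ (h * - d m)) (∙-*ᵛ (head m) t u)) (reorder h (d m) (head m * (t ∙ u)))
      where
      reorder : ∀ h x y → h * - x + y ≡ y - h * x
      reorder = solve-∀

    normal≢0ᵛ : u ≢ 0ᵛ → normal ≢ 0ᵛ
    normal≢0ᵛ u≢0 normal≡0 = u≢0 (*ᵛ≡0ᵛ⇒≡0ᵛ u (≢-sym (ℤP.<⇒≢ 0<hm)) (cong tail normal≡0))

    cross-nonneg : ∀ {a} → a ∈ A → 0ℤ ℤ.≤ head m * d a - head a * d m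
    cross-nonneg {a} a∈A with ℤP.<-cmp (head a) 0ℤ
    ... | tri< ha<0 _ _ = begin
      0ℤ                             ≤⟨ eliminated-nonneg (combine∈eliminated m∈A a∈A (ℤP.<⇒≤ 0<hm , ha<0)) ⟩
      combine (m , a) ∙ u            ≡⟨ combine-∙ m a u ⟩
      - head a * d m + head m * d a  ≡⟨ reorder (head a) (d m) (head m * d a) ⟩
      head m * d a - head a * d m    ∎
      where
      open ℤP.≤-Reasoning
      reorder : ∀ h x y → - h * x + y ≡ y - h * x
      reorder = solve-∀
    ... | tri≈ _ ha≡0 _ = begin
      0ℤ                             ≤⟨ 0≤i*j (ℤP.<⇒≤ 0<hm) (zero-head-nonneg a∈A ha≡0) ⟩
      head m * d a                   ≡⟨ ℤP.+-identityʳ _ ⟨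
      head m * d a - 0ℤ * d m        ≡⟨ cong (λ h → head m * d a - h * d m) ha≡0 ⟨
      head m * d a - head a * d m    ∎
      where open ℤP.≤-Reasoning
    ... | tri> _ _ 0<ha = begin
      0ℤ                             ≤⟨ ℤP.i≤j⇒0≤j-i (m-minimal a∈A 0<ha) ⟩
      d a * head m - d m * head a    ≡⟨ reorder (d a) (head m) (d m) (head a) ⟩
      head m * d a - head a * d m    ∎
      where
      open ℤP.≤-Reasoning
      reorder : ∀ x y z w → x * y - z * w ≡ y * x - w * z
      reorder = solve-∀

    A-in-halfspace : ∀ {a} → a ∈ A → 0ℤ ℤ.≤ a ∙ normal
    A-in-halfspace {a} a∈A = subst (0ℤ ℤ.≤_) (sym (normal-∙ a)) (cross-nonneg a∈A)

    spread-violated : u ≢ 0ᵛ → ⊥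
    spread-violated u≢0 with spread normal (normal≢0ᵛ u≢0)
    ... | a , a∈A , a∙normal<0 = ℤP.<⇒≱ a∙normal<0 (A-in-halfspace a∈A)

  eliminated-spread : Spread A → Spread eliminated
  eliminated-spread spread u u≢0 with any? (λ a → a ∙ u ℤ.<? 0ℤ) eliminated
  ... | yes negative  = find negative
  ... | no ¬negative = ⊥-elim (HalfSpace.spread-violated spread eliminated-nonneg u≢0)
    where
    eliminated-nonneg : ∀ {a} → a ∈ eliminated → 0ℤ ℤ.≤ a ∙ u
    eliminated-nonneg a∈ = ℤP.≮⇒≥ (¬negative ∘ lose a∈)

open Elimination using (eliminated; eliminated-spread; lift)

pivot-combination : ∀ S B G {hb h} (rb r : Vec ℤ n) → G * hb ≡ B * h →
  S *ᵛ G *ᵛ (hb ∷ rb) +ᵛ (0ℤ ∷ S *ᵛ (B *ᵛ r +ᵛ (- G) *ᵛ rb)) ≡ (S * B) *ᵛ (h ∷ r)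
pivot-combination S B G {hb} {h} rb r Ghb≡Bh = cong₂ _∷_ head-eq (tail-eq rb r)
  where
  open ≡-Reasoning
  head-eq : S * (G * hb) + 0ℤ ≡ S * B * h
  head-eq = begin
    S * (G * hb) + 0ℤ  ≡⟨ ℤP.+-identityʳ _ ⟩
    S * (G * hb)       ≡⟨ cong (S *_) Ghb≡Bh ⟩
    S * (B * h)        ≡⟨ ℤP.*-assoc S B h ⟨
    S * B * h          ∎
  cancel : ∀ S B G x y → S * (G * y) + S * (B * x + - G * y) ≡ S * B * x
  cancel = solve-∀
  tail-eq : (rb r : Vec ℤ n) → S *ᵛ G *ᵛ rb +ᵛ S *ᵛ (B *ᵛ r +ᵛ (- G) *ᵛ rb) ≡ (S * B) *ᵛ r
  tail-eq []       []      = refl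
  tail-eq (y ∷ rb) (x ∷ r) = cong₂ _∷_ (cancel S B G x y) (tail-eq rb r)

-- A pivot b ∈ A with γ · head b = (β + 1) · h leaves (β + 1) · (h ∷ r) - γ · b with zero head,
-- and its tail is positively spanned by the eliminated set, by induction on the dimension.
spread⇒positivelySpans : (A : List (Vec ℤ k)) → Spread A → PositivelySpans A
spread⇒positivelySpans {zero}  A _      [] = 0 , 0ᶜ
spread⇒positivelySpans {suc k} A spread (h ∷ r) with pivot spread h
... | hb ∷ rb , b∈A , β , γ , γhb≡βh
  with spread⇒positivelySpans (eliminated A) (eliminated-spread A spread)
                              (+[1+ β ] *ᵛ r +ᵛ (- + γ) *ᵛ rb)
... | s , cone =
  ℕ.pred (suc s ℕ.* suc β) ,
  subst (Cone A) (pivot-combination +[1+ s ] +[1+ β ] (+ γ) rb r γhb≡βh)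
                 (suc s *ᶜ γ *ᶜ gen b∈A +ᶜ lift A cone)

-- Somewhat spread sign vectors are spread

fromℤ-homo-+ : ∀ x y → fromℤ (x + y) ≡ fromℤ x ℚ.+ fromℤ y
fromℤ-homo-+ x y = ℚP.toℚᵘ-injective
  (ℚᵘP.≃-trans (ℚᵘ.*≡* (lemma x y)) (ℚᵘP.≃-sym (ℚP.toℚᵘ-homo-+ (fromℤ x) (fromℤ y))))
  where
  lemma : ∀ x y → (x + y) * 1ℤ ≡ (x * 1ℤ + y * 1ℤ) * 1ℤ
  lemma = solve-∀

fromℤ-homo-* : ∀ x y → fromℤ (x * y) ≡ fromℤ x ℚ.* fromℤ y
fromℤ-homo-* x y = ℚP.toℚᵘ-injective
  (ℚᵘP.≃-trans (ℚᵘ.*≡* refl) (ℚᵘP.≃-sym (ℚP.toℚᵘ-homo-* (fromℤ x) (fromℤ y))))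

fromℤ-mono-< : ∀ {x y} → x ℤ.< y → fromℤ x ℚ.< fromℤ y
fromℤ-mono-< {x} {y} x<y =
  ℚ.*<* (subst₂ ℤ._<_ (sym (ℤP.*-identityʳ x)) (sym (ℤP.*-identityʳ y)) x<y)

fromℤ-cancel-≤ : ∀ {x y} → fromℤ x ℚ.≤ fromℤ y → x ℤ.≤ y
fromℤ-cancel-≤ {x} {y} (ℚ.*≤* x≤y) = subst₂ ℤ._≤_ (ℤP.*-identityʳ x) (ℤP.*-identityʳ y) x≤y

dotℚ-fromℤ : (u v : Vec ℤ n) → dotℚ (map fromℤ u) (map fromℤ v) ≡ fromℤ (u ∙ v)
dotℚ-fromℤ []      []      = refl
dotℚ-fromℤ (x ∷ u) (y ∷ v) =
  trans (cong₂ ℚ._+_ (sym (fromℤ-homo-* x y)) (dotℚ-fromℤ u v)) (sym (fromℤ-homo-+ (x * y) (u ∙ v)))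

map-signℚ : (a : PM k) → map signℚ a ≡ map fromℤ (toℤv a)
map-signℚ a = trans (map-cong signℚ≡fromℤ∘signℤ a) (map-∘ fromℤ signℤ a)
  where
  signℚ≡fromℤ∘signℤ : ∀ s → signℚ s ≡ fromℤ (signℤ s)
  signℚ≡fromℤ∘signℤ Sign.+ = refl
  signℚ≡fromℤ∘signℤ Sign.- = refl

0<p*p*q : ∀ {p q} → 0ℚ < p → 0ℚ < q → 0ℚ < p ℚ.* p ℚ.* q
0<p*p*q {p} {q} 0<p 0<q = ℚP.positive⁻¹ _ {{ℚP.pos*pos⇒pos (p ℚ.* p) {{ℚP.pos*pos⇒pos p p}} q}}
  where
  instance
    p-positive : ℚ.Positive p
    p-positive = ℚ.positive 0<p
    q-positive : ℚ.Positive q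
    q-positive = ℚ.positive 0<q

0<|u|² : (u : Vec ℤ n) → u ≢ 0ᵛ → 0ℚ < dotℚ (map fromℤ u) (map fromℤ u)
0<|u|² u u≢0 = subst (0ℚ <_) (sym (dotℚ-fromℤ u u)) (fromℤ-mono-< (0<u∙u u u≢0))

somewhatSpread⇒spread : ∀ {ε} {A : List (PM k)} → 0ℚ < ε → SomewhatSpread ε A →
                        Spread (List.map toℤv A)
somewhatSpread⇒spread {ε = ε} 0<ε somewhatSpread u u≢0
  with somewhatSpread (map fromℤ u) (0<|u|² u u≢0)
... | a , a∈A , a∙u≤0 , ε²|u|²≤[a∙u]² =
  toℤv a , ∈-map⁺ toℤv a∈A , ℤP.≤∧≢⇒< (fromℤ-cancel-≤ (subst (ℚ._≤ 0ℚ) a∙u≡ a∙u≤0)) a∙u≢0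
  where
  a∙u≡ : dotℚ (map signℚ a) (map fromℤ u) ≡ fromℤ (toℤv a ∙ u)
  a∙u≡ = trans (cong (λ s → dotℚ s (map fromℤ u)) (map-signℚ a)) (dotℚ-fromℤ (toℤv a) u)
  a∙u≢0 : toℤv a ∙ u ≢ 0ℤ
  a∙u≢0 a∙u≡0 = ℚP.<-irrefl refl (ℚP.<-≤-trans (0<p*p*q 0<ε (0<|u|² u u≢0)) ε²|u|²≤0)
    where
    [a∙u]²≡0 : dotℚ (map signℚ a) (map fromℤ u) ℚ.* dotℚ (map signℚ a) (map fromℤ u) ≡ 0ℚ
    [a∙u]²≡0 =
      trans (cong (λ z → z ℚ.* z) (trans a∙u≡ (cong fromℤ a∙u≡0))) (sym (fromℤ-homo-* 0ℤ 0ℤ))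
    ε²|u|²≤0 : ε ℚ.* ε ℚ.* dotℚ (map fromℤ u) (map fromℤ u) ℚ.≤ 0ℚ
    ε²|u|²≤0 = subst (_ ℚ.≤_) [a∙u]²≡0 ε²|u|²≤[a∙u]²

lin : (A : List (PM k)) → Vec ℤ (length A) → Vec ℤ k
lin []      []       = 0ᵛ
lin (a ∷ A) (c ∷ cs) = c *ᵛ toℤv a +ᵛ lin A cs

total : Vec ℤ n → ℤ
total []       = 0ℤ
total (c ∷ cs) = c + total cs

0ᵛ-∷ʳ : ∀ n → 0ᵛ {suc n} ≡ 0ᵛ {n} ∷ʳ 0ℤ
0ᵛ-∷ʳ zero    = refl
0ᵛ-∷ʳ (suc n) = cong (0ℤ ∷_) (0ᵛ-∷ʳ n)

+ᵛ-∷ʳ : ∀ (u v : Vec ℤ n) x y → (u ∷ʳ x) +ᵛ (v ∷ʳ y) ≡ (u +ᵛ v) ∷ʳ (x + y)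
+ᵛ-∷ʳ []      []      x y = refl
+ᵛ-∷ʳ (a ∷ u) (b ∷ v) x y = cong (a + b ∷_) (+ᵛ-∷ʳ u v x y)

combℤ≡lin∷ʳtotal : (A : List (PM k)) (c : Vec ℤ (length A)) → combℤ A c ≡ lin A c ∷ʳ total c
combℤ≡lin∷ʳtotal {k} []      []       = 0ᵛ-∷ʳ k
combℤ≡lin∷ʳtotal     (a ∷ A) (c ∷ cs) = begin
  c *ᵛ prime a +ᵛ combℤ A cs
    ≡⟨ cong₂ _+ᵛ_ (map-∷ʳ (c *_) 1ℤ (toℤv a)) (combℤ≡lin∷ʳtotal A cs) ⟩
  (c *ᵛ toℤv a ∷ʳ c * 1ℤ) +ᵛ (lin A cs ∷ʳ total cs)
    ≡⟨ +ᵛ-∷ʳ (c *ᵛ toℤv a) (lin A cs) (c * 1ℤ) (total cs) ⟩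
  lin (a ∷ A) (c ∷ cs) ∷ʳ (c * 1ℤ + total cs)
    ≡⟨ cong (λ x → lin (a ∷ A) (c ∷ cs) ∷ʳ (x + total cs)) (ℤP.*-identityʳ c) ⟩
  lin (a ∷ A) (c ∷ cs) ∷ʳ total (c ∷ cs) ∎
  where open ≡-Reasoning

lin-0ᵛ : (A : List (PM k)) → lin A 0ᵛ ≡ 0ᵛ
lin-0ᵛ []      = refl
lin-0ᵛ (a ∷ A) = trans (cong₂ _+ᵛ_ (*ᵛ-zeroˡ (toℤv a)) (lin-0ᵛ A)) (+ᵛ-identityˡ 0ᵛ)

lin-+ᵛ : (A : List (PM k)) (c d : Vec ℤ (length A)) → lin A (c +ᵛ d) ≡ lin A c +ᵛ lin A d
lin-+ᵛ []      []       []       = sym (+ᵛ-identityˡ 0ᵛ)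
lin-+ᵛ (a ∷ A) (c ∷ cs) (d ∷ ds) = begin
  (c + d) *ᵛ toℤv a +ᵛ lin A (cs +ᵛ ds)
    ≡⟨ cong₂ _+ᵛ_ (*ᵛ-distribʳ-+ (toℤv a) c d) (lin-+ᵛ A cs ds) ⟩
  (c *ᵛ toℤv a +ᵛ d *ᵛ toℤv a) +ᵛ (lin A cs +ᵛ lin A ds)
    ≡⟨ +ᵛ-interchange (c *ᵛ toℤv a) (d *ᵛ toℤv a) (lin A cs) (lin A ds) ⟩
  (c *ᵛ toℤv a +ᵛ lin A cs) +ᵛ (d *ᵛ toℤv a +ᵛ lin A ds) ∎
  where open ≡-Reasoning

lin-*ᵛ : (A : List (PM k)) → ∀ m (c : Vec ℤ (length A)) → lin A (m *ᵛ c) ≡ m *ᵛ lin A c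
lin-*ᵛ {k} []      m []       = sym (*ᵛ-zeroʳ k m)
lin-*ᵛ     (a ∷ A) m (c ∷ cs) = begin
  (m * c) *ᵛ toℤv a +ᵛ lin A (m *ᵛ cs)
    ≡⟨ cong₂ _+ᵛ_ (*ᵛ-assoc m c (toℤv a)) (lin-*ᵛ A m cs) ⟩
  m *ᵛ c *ᵛ toℤv a +ᵛ m *ᵛ lin A cs
    ≡⟨ *ᵛ-distribˡ-+ᵛ m (c *ᵛ toℤv a) (lin A cs) ⟨
  m *ᵛ (c *ᵛ toℤv a +ᵛ lin A cs) ∎
  where open ≡-Reasoning

lin-+ᵛ-relation : (A : List (PM k)) {c r : Vec ℤ (length A)} {v : Vec ℤ k} →
                  lin A c ≡ v → lin A r ≡ 0ᵛ → lin A (c +ᵛ r) ≡ v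
lin-+ᵛ-relation A {c} {r} {v} lin-c lin-r =
  trans (lin-+ᵛ A c r) (trans (cong₂ _+ᵛ_ lin-c lin-r) (+ᵛ-identityʳ v))

lin-*ᵛ-relation : (A : List (PM k)) {r : Vec ℤ (length A)} →
                  ∀ m → lin A r ≡ 0ᵛ → lin A (m *ᵛ r) ≡ 0ᵛ
lin-*ᵛ-relation {k} A {r} m lin-r = trans (lin-*ᵛ A m r) (trans (cong (m *ᵛ_) lin-r) (*ᵛ-zeroʳ k m))

total-+ᵛ : (c d : Vec ℤ n) → total (c +ᵛ d) ≡ total c + total d
total-+ᵛ []       []       = refl
total-+ᵛ (c ∷ cs) (d ∷ ds) =
  trans (cong (_+_ (c + d)) (total-+ᵛ cs ds)) (interchange c d (total cs) (total ds))

total-*ᵛ : ∀ m (c : Vec ℤ n) → total (m *ᵛ c) ≡ m * total c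
total-*ᵛ m []       = sym (ℤP.*-zeroʳ m)
total-*ᵛ m (c ∷ cs) =
  trans (cong (_+_ (m * c)) (total-*ᵛ m cs)) (sym (ℤP.*-distribˡ-+ m c (total cs)))

indicator : ∀ {P : PM k → Set} {A} → Any P A → Vec ℤ (length A)
indicator (here _)  = 1ℤ ∷ 0ᵛ
indicator (there p) = 0ℤ ∷ indicator p

lin-indicator : ∀ {A : List (PM k)} {v} (p : Any (λ a → v ≡ toℤv a) A) → lin A (indicator p) ≡ v
lin-indicator {A = a ∷ A} (here refl) =
  trans (cong₂ _+ᵛ_ (*ᵛ-identityˡ (toℤv a)) (lin-0ᵛ A)) (+ᵛ-identityʳ (toℤv a))
lin-indicator {A = a ∷ A} (there p)   =
  trans (cong₂ _+ᵛ_ (*ᵛ-zeroˡ (toℤv a)) (lin-indicator p)) (+ᵛ-identityˡ _)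

All-replicate : ∀ {P : ℤ → Set} {x} → P x → All P (replicate n x)
All-replicate {zero}  px = []
All-replicate {suc n} px = px ∷ All-replicate px

indicator-nonneg : ∀ {P : PM k → Set} {A} (p : Any P A) → All (0ℤ ℤ.≤_) (indicator p)
indicator-nonneg (here _)  = +≤+ z≤n ∷ All-replicate ℤP.≤-refl
indicator-nonneg (there p) = ℤP.≤-refl ∷ indicator-nonneg p

cone⇒coefficients : ∀ {A : List (PM k)} {v} → Cone (List.map toℤv A) v →
                    ∃ λ c → All (0ℤ ℤ.≤_) c × lin A c ≡ v
cone⇒coefficients {A = A} 0ᶜ = 0ᵛ , All-replicate ℤP.≤-refl , lin-0ᵛ A
cone⇒coefficients (gen v∈) = indicator p , indicator-nonneg p , lin-indicator p
  where p = AnyP.map⁻ v∈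
cone⇒coefficients {A = A} (x +ᶜ y) with cone⇒coefficients x | cone⇒coefficients y
... | c , c≥0 , lin-c | d , d≥0 , lin-d =
  c +ᵛ d , All.zipWith ℤP.+-mono-≤ c≥0 d≥0 , trans (lin-+ᵛ A c d) (cong₂ _+ᵛ_ lin-c lin-d)
cone⇒coefficients {A = A} (m *ᶜ x) with cone⇒coefficients x
... | c , c≥0 , lin-c =
  + m *ᵛ c , AllP.map⁺ (All.map (0≤i*j {+ m} (+≤+ z≤n)) c≥0) ,
  trans (lin-*ᵛ A (+ m) c) (cong (+ m *ᵛ_) lin-c)

positive-relation : (A : List (PM k)) → Spread (List.map toℤv A) →
                    ∃ λ w → All (1ℤ ℤ.≤_) w × lin A w ≡ 0ᵛ
positive-relation A spread with spread⇒positivelySpans _ spread (lin A (replicate _ -1ℤ))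
... | s , cone with cone⇒coefficients cone
... | c , c≥0 , lin-c = c +ᵛ Sᵛ , w≥1 , lin-w
  where
  S = +[1+ s ]
  Sᵛ = replicate (length A) S
  w≥1 : All (1ℤ ℤ.≤_) (c +ᵛ Sᵛ)
  w≥1 = All.zipWith {Q = 1ℤ ℤ.≤_} ℤP.+-mono-≤ c≥0 (All-replicate (+≤+ (s≤s z≤n)))
  inverse : ∀ x → x * -1ℤ + x ≡ 0ℤ
  inverse = solve-∀
  cancel : S *ᵛ replicate _ -1ℤ +ᵛ Sᵛ ≡ 0ᵛ
  cancel = trans (cong (_+ᵛ Sᵛ) (map-replicate (S *_) -1ℤ _))
                 (trans (zipWith-replicate _+_ (S * -1ℤ) S) (cong (replicate _) (inverse S)))
  open ≡-Reasoning
  lin-w : lin A (c +ᵛ Sᵛ) ≡ 0ᵛ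
  lin-w = begin
    lin A (c +ᵛ Sᵛ)
      ≡⟨ lin-+ᵛ A c Sᵛ ⟩
    lin A c +ᵛ lin A Sᵛ
      ≡⟨ cong (_+ᵛ lin A Sᵛ) lin-c ⟩
    S *ᵛ lin A (replicate _ -1ℤ) +ᵛ lin A Sᵛ
      ≡⟨ cong (_+ᵛ lin A Sᵛ) (lin-*ᵛ A S (replicate _ -1ℤ)) ⟨
    lin A (S *ᵛ replicate _ -1ℤ) +ᵛ lin A Sᵛ
      ≡⟨ lin-+ᵛ A (S *ᵛ replicate _ -1ℤ) Sᵛ ⟨
    lin A (S *ᵛ replicate _ -1ℤ +ᵛ Sᵛ)
      ≡⟨ cong (lin A) cancel ⟩
    lin A 0ᵛ
      ≡⟨ lin-0ᵛ A ⟩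
    0ᵛ ∎

All-∷ʳ : ∀ {P : ℤ → Set} {xs : Vec ℤ n} {y} → All P xs → P y → All P (xs ∷ʳ y)
All-∷ʳ []         py = py ∷ []
All-∷ʳ (px ∷ pxs) py = px ∷ All-∷ʳ pxs py

congruent⇒sameParity : ∀ r (v : Vec ℤ n) → All (λ x → + 2 ℤD.∣ x - r) v → SameParity v
congruent⇒sameParity r v congruent i j =
  ∣⇒∣ᵤ (subst (λ z → + 2 ℤDˢ.∣ z) (difference (Vec.lookup v i) (Vec.lookup v j) r)
              (∣m∣n⇒∣m-n (∣ᵤ⇒∣ {i = Vec.lookup v i - r} (AllP.lookup⁺ congruent i))
                          (∣ᵤ⇒∣ {i = Vec.lookup v j - r} (AllP.lookup⁺ congruent j))))
  where
  difference : ∀ x y r → (x - r) - (y - r) ≡ x - y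
  difference = solve-∀

signs∷ʳ1-sameParity : (x : PM k) → SameParity (toℤv x ∷ʳ 1ℤ)
signs∷ʳ1-sameParity x =
  congruent⇒sameParity 1ℤ _ (All-∷ʳ (AllP.map⁺ (All.universal odd x)) (ℕD._∣0 2))
  where
  odd : ∀ s → + 2 ℤD.∣ signℤ s - 1ℤ
  odd Sign.+ = ℕD._∣0 2
  odd Sign.- = ℕD.∣-refl

zeros∷ʳ2-sameParity : ∀ k → SameParity (0ᵛ {k} ∷ʳ + 2)
zeros∷ʳ2-sameParity k = congruent⇒sameParity 0ℤ _ (All-∷ʳ (All-replicate (ℕD._∣0 2)) ℕD.∣-refl)

lattice-coefficients : (A : List (PM k)) {v : Vec ℤ k} {t : ℤ} →
                       InLattice A (v ∷ʳ t) → ∃ λ c → lin A c ≡ v × total c ≡ t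
lattice-coefficients A (c , combℤ≡) =
  c , ∷ʳ-injective (lin A c) _ (trans (sym (combℤ≡lin∷ʳtotal A c)) combℤ≡)

-- Large odd heights

odd-decomposition : ∀ N .{{_ : ℕ.NonZero N}} B ℓ → suc (B ℕ.* N ℕ.* 2) ≤ ℓ → ℓ % 2 ≡ 1 →
                    ∃₂ λ j M → j ℕ.< N × B ≤ M × ℓ ≡ 1 ℕ.+ j ℕ.* 2 ℕ.+ M ℕ.* N
odd-decomposition N B ℓ L≤ℓ ℓ-odd = q % N , 2 ℕ.* (q / N) , m%n<n q N , B≤M , ℓ≡
  where
  q = ℓ / 2
  ℓ≡1+q*2 : ℓ ≡ 1 ℕ.+ q ℕ.* 2
  ℓ≡1+q*2 = trans (m≡m%n+[m/n]*n ℓ 2) (cong (ℕ._+ q ℕ.* 2) ℓ-odd)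
  BN≤q : B ℕ.* N ≤ q
  BN≤q = ℕP.*-cancelʳ-≤ (B ℕ.* N) q 2 (ℕ.s≤s⁻¹ (subst (suc (B ℕ.* N ℕ.* 2) ≤_) ℓ≡1+q*2 L≤ℓ))
  B≤M : B ≤ 2 ℕ.* (q / N)
  B≤M = ℕP.≤-trans (subst (_≤ q / N) (m*n/n≡m B N) (/-monoˡ-≤ N BN≤q)) (ℕP.m≤n*m (q / N) 2)
  regroup : ∀ j m N → 1 ℕ.+ (j ℕ.+ m ℕ.* N) ℕ.* 2 ≡ 1 ℕ.+ j ℕ.* 2 ℕ.+ 2 ℕ.* m ℕ.* N
  regroup = ℕ-Solver.solve-∀
  ℓ≡ : ℓ ≡ 1 ℕ.+ q % N ℕ.* 2 ℕ.+ 2 ℕ.* (q / N) ℕ.* N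
  ℓ≡ = trans ℓ≡1+q*2
             (trans (cong (λ p → 1 ℕ.+ p ℕ.* 2) (m≡m%n+[m/n]*n q N)) (regroup (q % N) (q / N) N))

Bounded : ℕ → Vec ℤ n → Set
Bounded K = All (λ x → ∣ x ∣ ≤ K)

bounded-weaken : ∀ {K M} {v : Vec ℤ n} → K ≤ M → Bounded K v → Bounded M v
bounded-weaken K≤M = All.map (λ x≤K → ℕP.≤-trans x≤K K≤M)

bounded : (v : Vec ℤ n) → ∃ λ K → Bounded K v
bounded []      = 0 , []
bounded (x ∷ v) with bounded v
... | K , v≤K = ∣ x ∣ ℕ.⊔ K , ℕP.m≤m⊔n ∣ x ∣ K ∷ bounded-weaken (ℕP.m≤n⊔m ∣ x ∣ K) v≤K

+ᵛ-*ᵛ-bounded : ∀ {K₀ K₁} j {c d : Vec ℤ n} → Bounded K₀ c → Bounded K₁ d →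
                Bounded (K₀ ℕ.+ j ℕ.* K₁) (c +ᵛ + j *ᵛ d)
+ᵛ-*ᵛ-bounded j [] [] = []
+ᵛ-*ᵛ-bounded {K₁ = K₁} j {x ∷ _} {y ∷ _} (x≤K₀ ∷ c≤K₀) (y≤K₁ ∷ d≤K₁) =
  ℕP.≤-trans (ℤP.∣i+j∣≤∣i∣+∣j∣ x (+ j * y)) (ℕP.+-mono-≤ x≤K₀ jy≤jK₁) ∷ +ᵛ-*ᵛ-bounded j c≤K₀ d≤K₁
  where
  jy≤jK₁ : ∣ + j * y ∣ ≤ j ℕ.* K₁
  jy≤jK₁ = ℕP.≤-trans (ℕP.≤-reflexive (ℤP.abs-* (+ j) y)) (ℕP.*-monoʳ-≤ j y≤K₁)

absorb : ∀ {M} {v w : Vec ℤ n} → Bounded M v → All (1ℤ ℤ.≤_) w → All (0ℤ ℤ.≤_) (v +ᵛ + M *ᵛ w)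
absorb [] [] = []
absorb {M = M} {x ∷ _} {y ∷ _} (x≤M ∷ v≤M) (1≤y ∷ w≥1) = entry {x} x≤M M≤M*y ∷ absorb v≤M w≥1
  where
  M≤M*y : + M ℤ.≤ + M * y
  M≤M*y = subst (ℤ._≤ + M * y) (ℤP.*-identityʳ (+ M)) (ℤP.*-monoˡ-≤-nonNeg (+ M) 1≤y)
  entry : ∀ {x z} → ∣ x ∣ ≤ M → + M ℤ.≤ z → 0ℤ ℤ.≤ x + z
  entry {+ _}                 _       M≤z = ℤP.+-mono-≤ (+≤+ z≤n) (ℤP.≤-trans (+≤+ z≤n) M≤z)
  entry { -[1+ n ]} {z} 1+n≤M M≤z =
    subst (0ℤ ℤ.≤_) (ℤP.+-comm z -[1+ n ]) (ℤP.i≤j⇒0≤j-i (ℤP.≤-trans (+≤+ 1+n≤M) M≤z))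

length≤total : {w : Vec ℤ n} → All (1ℤ ℤ.≤_) w → + n ℤ.≤ total w
length≤total []       = ℤP.≤-refl
length≤total (p ∷ ps) = ℤP.+-mono-≤ p (length≤total ps)

total≡1⇒nonempty : (c : Vec ℤ n) → total c ≡ 1ℤ → 1 ≤ n
total≡1⇒nonempty (_ ∷ _) _ = s≤s z≤n

1≤i⇒i≡+[1+] : ∀ {i} → 1ℤ ℤ.≤ i → ∃ λ N → i ≡ +[1+ N ]
1≤i⇒i≡+[1+] (+≤+ (s≤s _)) = _ , refl

total-combination : ∀ (c d w : Vec ℤ n) {N} j M → total c ≡ 1ℤ → total d ≡ + 2 → total w ≡ + N →
                    total (c +ᵛ + j *ᵛ d +ᵛ + M *ᵛ w) ≡ + (1 ℕ.+ j ℕ.* 2 ℕ.+ M ℕ.* N)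
total-combination c d w {N} j M total-c total-d total-w = begin
  total (c +ᵛ + j *ᵛ d +ᵛ + M *ᵛ w)
    ≡⟨ total-+ᵛ (c +ᵛ + j *ᵛ d) (+ M *ᵛ w) ⟩
  total (c +ᵛ + j *ᵛ d) + total (+ M *ᵛ w)
    ≡⟨ cong₂ _+_ (total-+ᵛ c (+ j *ᵛ d)) (total-*ᵛ (+ M) w) ⟩
  total c + total (+ j *ᵛ d) + + M * total w
    ≡⟨ cong₂ (λ x y → total c + x + + M * y) (total-*ᵛ (+ j) d) total-w ⟩
  total c + + j * total d + + M * + N
    ≡⟨ cong₂ (λ x y → x + + j * y + + M * + N) total-c total-d ⟩
  1ℤ + + j * + 2 + + M * + N
    ≡⟨ cong₂ _+_ (cong (_+_ 1ℤ) (ℤP.pos-* j 2)) (ℤP.pos-* M N) ⟨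
  1ℤ + + (j ℕ.* 2) + + (M ℕ.* N)
    ≡⟨ cong (_+ + (M ℕ.* N)) (ℤP.pos-+ 1 (j ℕ.* 2)) ⟨
  + (1 ℕ.+ j ℕ.* 2) + + (M ℕ.* N)
    ≡⟨ ℤP.pos-+ (1 ℕ.+ j ℕ.* 2) (M ℕ.* N) ⟨
  + (1 ℕ.+ j ℕ.* 2 ℕ.+ M ℕ.* N) ∎
  where open ≡-Reasoning

nonneg-combℕ : (A : List (PM k)) {e : Vec ℤ (length A)} {v : Vec ℤ k} {t : ℤ} →
               All (0ℤ ℤ.≤_) e → lin A e ≡ v → total e ≡ t → combℕ A (map ∣_∣ e) ≡ v ∷ʳ t
nonneg-combℕ A {e} {v} {t} e≥0 lin-e total-e = begin
  combℤ A (map +_ (map ∣_∣ e))  ≡⟨ cong (combℤ A) (+∣∣ e≥0) ⟩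
  combℤ A e                     ≡⟨ combℤ≡lin∷ʳtotal A e ⟩
  lin A e ∷ʳ total e            ≡⟨ cong₂ _∷ʳ_ lin-e total-e ⟩
  v ∷ʳ t                        ∎
  where
  open ≡-Reasoning
  +∣∣ : ∀ {e : Vec ℤ n} → All (0ℤ ℤ.≤_) e → map +_ (map ∣_∣ e) ≡ e
  +∣∣ []       = refl
  +∣∣ (p ∷ ps) = cong₂ _∷_ (ℤP.0≤i⇒+∣i∣≡i p) (+∣∣ ps)

representable-at-large-odd-heights :
  (A : List (PM k)) {v : Vec ℤ k} →
  (∃ λ c → lin A c ≡ v × total c ≡ 1ℤ) →
  (∃ λ d → lin A d ≡ 0ᵛ × total d ≡ + 2) →
  (∃ λ w → All (1ℤ ℤ.≤_) w × lin A w ≡ 0ᵛ) →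
  ∃ λ L → (ℓ : ℕ) → L ≤ ℓ → ℓ % 2 ≡ 1 → ∃ λ e → combℕ A e ≡ v ∷ʳ + ℓ
representable-at-large-odd-heights A {v} (c , lin-c , total-c) (d , lin-d , total-d)
                                         (w , w≥1 , lin-w)
  with 1≤i⇒i≡+[1+] (ℤP.≤-trans (+≤+ (total≡1⇒nonempty c total-c)) (length≤total w≥1))
     | bounded c | bounded d
... | N₀ , total-w | K₀ , c≤K₀ | K₁ , d≤K₁ = suc (B ℕ.* N ℕ.* 2) , representation
  where
  N = suc N₀
  B = K₀ ℕ.+ N ℕ.* K₁
  representation : ∀ ℓ → suc (B ℕ.* N ℕ.* 2) ≤ ℓ → ℓ % 2 ≡ 1 → ∃ λ e → combℕ A e ≡ v ∷ʳ + ℓ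
  representation ℓ L≤ℓ ℓ-odd with odd-decomposition N B ℓ L≤ℓ ℓ-odd
  ... | j , M , j<N , B≤M , ℓ≡ = map ∣_∣ e , nonneg-combℕ A e≥0 lin-e total-e
    where
    e = c +ᵛ + j *ᵛ d +ᵛ + M *ᵛ w
    K≤M : K₀ ℕ.+ j ℕ.* K₁ ≤ M
    K≤M = ℕP.≤-trans (ℕP.+-monoʳ-≤ K₀ (ℕP.*-monoˡ-≤ K₁ (ℕP.<⇒≤ j<N))) B≤M
    e≥0 : All (0ℤ ℤ.≤_) e
    e≥0 = absorb (bounded-weaken K≤M (+ᵛ-*ᵛ-bounded j c≤K₀ d≤K₁)) w≥1
    lin-e : lin A e ≡ v
    lin-e = lin-+ᵛ-relation A (lin-+ᵛ-relation A lin-c (lin-*ᵛ-relation A (+ j) lin-d))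
                              (lin-*ᵛ-relation A (+ M) lin-w)
    total-e : total e ≡ + ℓ
    total-e = trans (total-combination c d w j M total-c total-d total-w) (cong +_ (sym ℓ≡))

lemma7p8 : (k : ℕ) (ε : ℚ) (A : List (PM k)) → 0ℚ < ε →
  ModularFree A → SomewhatSpread ε A →
  (x : PM k) → ∃ λ (L : ℕ) → (ℓ : ℕ) → L ≤ ℓ → ℓ % 2 ≡ 1 →
    ∃ λ (c : Vec ℕ (length A)) → combℕ A c ≡ (toℤv x ∷ʳ + ℓ)
lemma7p8 k ε A 0<ε modularFree somewhatSpread x = representable-at-large-odd-heights A
  (lattice-coefficients A (Equivalence.from (modularFree _) (signs∷ʳ1-sameParity x)))
  (lattice-coefficients A (Equivalence.from (modularFree _) (zeros∷ʳ2-sameParity k)))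
  (positive-relation A (somewhatSpread⇒spread 0<ε somewhatSpread))
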